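{- Let $\mathbf{v},\mathbf{w},\mathbf{k},\boldsymbol{\ell}$ be $m$-tuples of positive integers with $k_i\ge 2$ for all $i$, satisfying $\mathbf{k}\le\mathbf{w}\le\mathbf{v}$ and $\mathbf{k}\le\boldsymbol{\ell}\le\mathbf{v}$ (componentwise). Then $C(\mathbf{v},\mathbf{k},2)\ge C(\mathbf{w},\mathbf{k},2)$ and $C(\mathbf{v},\mathbf{k},2)\ge C(\mathbf{v},\boldsymbol{\ell},2)$.
   Context: Generalized covering designs: for $m$-tuples of positive integers $\mathbf{v}=(v_1,\dots,v_m)$, $\mathbf{k}=(k_1,\dots,k_m)$ with $k_i\le v_i$ and an integer $t$ with $1\le t\le \sum_i k_i$, let $X_1,\dots,X_m$ be pairwise disjoint sets with $|X_i|=v_i$. A block is an $m$-tuple $(B_1,\dots,B_m)$ with $B_i\subseteq X_i$, $|B_i|=k_i$. An $m$-tuple of sets $(T_1,\dots,T_m)$ is $(\mathbf{v},\mathbf{k},t)$-admissible if $T_i\subseteq X_i$, $|T_i|\le k_i$ and $\sum_i|T_i|=t$; it is contained in a block if $T_i\subseteq B_i$ for all $i$. A ${\rm GC}(\mathbf{v},\mathbf{k},t)$ is a family of blocks (repetitions allowed) such that every admissible tuple is contained in at least one block, and $C(\mathbf{v},\mathbf{k},t)$ is the minimum number of blocks of a ${\rm GC}(\mathbf{v},\mathbf{k},t)$ (taken to be $0$ if no design exists or there are no admissible tuples). -}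

module Defs where

open import Data.Nat using (ℕ; zero; suc; _+_; _≤_)
open import Data.Fin using (Fin)
open import Data.Fin.Subset using (Subset; ∣_∣; _⊆_)
open import Data.Vec.Functional using (foldr)
open import Data.Product using (Σ; _×_)
open import Data.Sum using (_⊎_)
open import Relation.Binary.PropositionalEquality using (_≡_)
open import Relation.Nullary using (¬_)

-- m-tuples of natural numbers are functions Fin m → ℕ.
-- The ground set X_i is Fin (v i); disjointness is built in (each
-- component lives in its own coordinate).

sumTuple : ∀ {m} → (Fin m → ℕ) → ℕ
sumTuple f = foldr _+_ 0 f

_≤ᵗ_ : ∀ {m} → (Fin m → ℕ) → (Fin m → ℕ) → Set
a ≤ᵗ b = ∀ i → a i ≤ b i

SetTuple : ∀ {m} → (Fin m → ℕ) → Set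
SetTuple {m} v = (i : Fin m) → Subset (v i)

IsBlock : ∀ {m} (v k : Fin m → ℕ) → SetTuple v → Set
IsBlock v k B = ∀ i → ∣ B i ∣ ≡ k i

Admissible : ∀ {m} (v k : Fin m → ℕ) (t : ℕ) → SetTuple v → Set
Admissible v k t T = (∀ i → ∣ T i ∣ ≤ k i) × sumTuple (λ i → ∣ T i ∣) ≡ t

ContainedIn : ∀ {m} {v : Fin m → ℕ} → SetTuple v → SetTuple v → Set
ContainedIn T B = ∀ i → T i ⊆ B i

-- A GC(v,k,t) with exactly n blocks (an indexed family, so repetitions allowed).
IsGC : ∀ {m} (v k : Fin m → ℕ) (t n : ℕ) → (Fin n → SetTuple v) → Set
IsGC v k t n 𝓑 =
  (∀ j → IsBlock v k (𝓑 j)) ×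
  (∀ T → Admissible v k t T → Σ (Fin _) λ j → ContainedIn T (𝓑 j))

HasGC : ∀ {m} (v k : Fin m → ℕ) (t n : ℕ) → Set
HasGC v k t n = Σ (Fin n → SetTuple _) λ 𝓑 → IsGC v k t n 𝓑

-- c = C(v,k,t): c is the minimum size of a GC(v,k,t), or c = 0 if no GC exists.
-- (If there are no admissible tuples, the empty family is a GC, so the
-- minimum is 0 automatically.)
IsCoveringNumber : ∀ {m} (v k : Fin m → ℕ) (t c : ℕ) → Set
IsCoveringNumber v k t c =
  (HasGC v k t c × (∀ n → HasGC v k t n → c ≤ n))
  ⊎ ((∀ n → ¬ HasGC v k t n) × c ≡ 0)

-- Both inequalities come from transporting a covering of size n for (v, k, 2) to one of the
-- same size for the other parameters. To shrink the ground sets to w, cut every block down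
-- to its first w_i points and refill it to k_i points; an admissible tuple over w, read over
-- v, was in some block, hence in the cut-down one. To enlarge blocks to l, fill every block up
-- to l_i points; an admissible tuple for l has parts of size at most t = 2 ≤ k_i, so it is
-- already admissible for k. A covering for (v, k, 2) exists (one block per tuple of subsets),
-- so C(v, k, 2) is a genuine minimum and bounds the other two covering numbers.
module Submission where

open import Defs
open import Data.Bool using (Bool; true; false)
open import Data.Empty using (⊥-elim)
open import Data.Fin using (Fin; zero; suc; combine; remQuot)
open import Data.Fin.Properties using (remQuot-combine)
open import Data.Fin.Subset using (Subset; ∣_∣; _⊆_; ⊥; ⊤; inside; outside)
open import Data.Fin.Subset.Properties
  using (∣⊥∣≡0; ∣⊤∣≡n; ⊆⊤; ⊆-trans; in⊆in; out⊆; drop-∷-⊆; p⊆q⇒∣p∣≤∣q∣)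
open import Data.Nat using (ℕ; zero; suc; _+_; _*_; _≤_; z≤n; s≤s; _≤?_)
open import Data.Nat.Properties using (≤-trans; ≤-antisym; ≰⇒>; m≤m+n; m≤n+m)
open import Data.Product using (Σ; ∃; _×_; _,_; proj₁; proj₂)
open import Data.Sum using (inj₁; inj₂)
open import Data.Vec using ([]; _∷_; here; there; tabulate; lookup)
open import Data.Vec.Properties using (tabulate-cong; tabulate∘lookup)
open import Function using (_∘_)
open import Relation.Nullary using (yes; no)
open import Relation.Binary.PropositionalEquality using (_≡_; refl; sym; trans; cong; cong₂; subst)

Enumeration : Set → Set
Enumeration A = Σ ℕ λ N → Σ (Fin N → A) λ e → ∀ x → ∃ λ j → e j ≡ x

-- Functions are compared pointwise, as no function extensionality is available.
Π-Enumeration : ∀ {m} → (Fin m → Set) → Set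
Π-Enumeration {m} A = Σ ℕ λ N → Σ (Fin N → (i : Fin m) → A i) λ e →
  ∀ (x : (i : Fin m) → A i) → ∃ λ j → ∀ i → e j i ≡ x i

Bool-enumeration : Enumeration Bool
Bool-enumeration = 2 , (λ { zero → false ; (suc _) → true }) ,
  λ { false → zero , refl ; true → suc zero , refl }

Π-enumeration : ∀ m {A : Fin m → Set} → (∀ i → Enumeration (A i)) → Π-Enumeration A
Π-enumeration zero    E = 1 , (λ _ ()) , λ _ → zero , λ ()
Π-enumeration (suc m) {A} E
  with N , e , e-onto ← E zero | M , f , f-onto ← Π-enumeration m (E ∘ suc)
  = N * M , cons ∘ remQuot M , onto
  where
  cons : Fin N × Fin M → (i : Fin (suc m)) → A i
  cons (a , b) zero    = e a
  cons (a , b) (suc i) = f b i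

  onto : ∀ (x : (i : Fin (suc m)) → A i) → ∃ λ j → ∀ i → cons (remQuot M j) i ≡ x i
  onto x with a , ea ← e-onto (x zero) | b , fb ← f-onto (x ∘ suc) =
    combine a b , λ i → trans (cong (λ p → cons p i) (remQuot-combine a b)) (cons-correct i)
    where
    cons-correct : ∀ i → cons (a , b) i ≡ x i
    cons-correct zero    = ea
    cons-correct (suc i) = fb i

Subset-enumeration : ∀ n → Enumeration (Subset n)
Subset-enumeration n with N , e , e-onto ← Π-enumeration n (λ _ → Bool-enumeration) =
  N , tabulate ∘ e ,
  λ p → let j , ej = e-onto (lookup p)
        in j , trans (tabulate-cong ej) (tabulate∘lookup p)

SetTuple-enumeration : ∀ {m} (v : Fin m → ℕ) → Π-Enumeration (λ i → Subset (v i))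
SetTuple-enumeration {m} v = Π-enumeration m (Subset-enumeration ∘ v)

⊆-extend : ∀ {n k} (p : Subset n) → ∣ p ∣ ≤ k → k ≤ n → ∃ λ q → p ⊆ q × ∣ q ∣ ≡ k
⊆-extend {zero} {zero} [] _ _ = [] , (λ ()) , refl
⊆-extend {suc n} {suc k} (inside ∷ p) (s≤s ∣p∣≤k) (s≤s k≤n)
  with q , p⊆q , ∣q∣≡k ← ⊆-extend p ∣p∣≤k k≤n = inside ∷ q , in⊆in p⊆q , cong suc ∣q∣≡k
⊆-extend {suc n} {k} (outside ∷ p) ∣p∣≤k k≤1+n with k ≤? n
... | yes k≤n with q , p⊆q , ∣q∣≡k ← ⊆-extend p ∣p∣≤k k≤n = outside ∷ q , out⊆ p⊆q , ∣q∣≡k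
... | no  k≰n = ⊤ , ⊆⊤ , trans (∣⊤∣≡n (suc n)) (≤-antisym (≰⇒> k≰n) k≤1+n)

completion : ∀ {n k} → k ≤ n → (p : Subset n) → ∃ λ q → (∣ p ∣ ≤ k → p ⊆ q) × ∣ q ∣ ≡ k
completion {n} {k} k≤n p with ∣ p ∣ ≤? k
... | yes ∣p∣≤k with q , p⊆q , ∣q∣≡k ← ⊆-extend p ∣p∣≤k k≤n = q , (λ _ → p⊆q) , ∣q∣≡k
... | no  ∣p∣≰k with q , _ , ∣q∣≡k ← ⊆-extend ⊥ (subst (_≤ k) (sym (∣⊥∣≡0 n)) z≤n) k≤n =
  q , (λ ∣p∣≤k → ⊥-elim (∣p∣≰k ∣p∣≤k)) , ∣q∣≡k

HasGC-exists : ∀ {m} {v k : Fin m → ℕ} {t} → k ≤ᵗ v → ∃ λ N → HasGC v k t N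
HasGC-exists {v = v} {k} k≤v with N , e , e-onto ← SetTuple-enumeration v =
  N , (λ j i → proj₁ (complete j i)) , (λ j i → proj₂ (proj₂ (complete j i))) , covers
  where
  complete : ∀ j i → ∃ λ q → (∣ e j i ∣ ≤ k i → e j i ⊆ q) × ∣ q ∣ ≡ k i
  complete j i = completion (k≤v i) (e j i)

  covers : ∀ T → Admissible v k _ T → ∃ λ j → ContainedIn T (λ i → proj₁ (complete j i))
  covers T (∣T∣≤k , _) with j , ej ← e-onto T =
    j , λ i → subst (_⊆ proj₁ (complete j i)) (ej i)
                (proj₁ (proj₂ (complete j i)) (subst (λ p → ∣ p ∣ ≤ k i) (sym (ej i)) (∣T∣≤k i)))

sumTuple-cong : ∀ {m} {f g : Fin m → ℕ} → (∀ i → f i ≡ g i) → sumTuple f ≡ sumTuple g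
sumTuple-cong {zero}  f≗g = refl
sumTuple-cong {suc m} f≗g = cong₂ _+_ (f≗g zero) (sumTuple-cong (f≗g ∘ suc))

≤-sumTuple : ∀ {m} (f : Fin m → ℕ) i → f i ≤ sumTuple f
≤-sumTuple f zero    = m≤m+n (f zero) _
≤-sumTuple f (suc i) = ≤-trans (≤-sumTuple (f ∘ suc) i) (m≤n+m _ (f zero))

pad : ∀ {a b} → a ≤ b → Subset a → Subset b
pad z≤n       []      = ⊥
pad (s≤s a≤b) (x ∷ p) = x ∷ pad a≤b p

restrict : ∀ {a b} → a ≤ b → Subset b → Subset a
restrict z≤n       _       = []
restrict (s≤s a≤b) (x ∷ p) = x ∷ restrict a≤b p

∣pad∣≡∣p∣ : ∀ {a b} (a≤b : a ≤ b) p → ∣ pad a≤b p ∣ ≡ ∣ p ∣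
∣pad∣≡∣p∣ {b = b} z≤n [] = ∣⊥∣≡0 b
∣pad∣≡∣p∣ (s≤s a≤b) (inside  ∷ p) = cong suc (∣pad∣≡∣p∣ a≤b p)
∣pad∣≡∣p∣ (s≤s a≤b) (outside ∷ p) = ∣pad∣≡∣p∣ a≤b p

∣restrict∣≤∣p∣ : ∀ {a b} (a≤b : a ≤ b) p → ∣ restrict a≤b p ∣ ≤ ∣ p ∣
∣restrict∣≤∣p∣ z≤n       _             = z≤n
∣restrict∣≤∣p∣ (s≤s a≤b) (inside  ∷ p) = s≤s (∣restrict∣≤∣p∣ a≤b p)
∣restrict∣≤∣p∣ (s≤s a≤b) (outside ∷ p) = ∣restrict∣≤∣p∣ a≤b p

pad⊆⇒⊆restrict : ∀ {a b} (a≤b : a ≤ b) {p q} → pad a≤b p ⊆ q → p ⊆ restrict a≤b q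
pad⊆⇒⊆restrict z≤n {[]} _ ()
pad⊆⇒⊆restrict (s≤s a≤b) {_ ∷ _} {_ ∷ _} p⊆q here with p⊆q here
... | here = here
pad⊆⇒⊆restrict (s≤s a≤b) {_ ∷ _} {_ ∷ _} p⊆q (there x) =
  there (pad⊆⇒⊆restrict a≤b (drop-∷-⊆ p⊆q) x)

HasGC-shrinkPoints : ∀ {m} {v w k : Fin m → ℕ} {t n} → k ≤ᵗ w → w ≤ᵗ v →
  HasGC v k t n → HasGC w k t n
HasGC-shrinkPoints {v = v} {w} {k} {t} {n} k≤w w≤v (𝓑 , isBlock , covers) =
  (λ j i → proj₁ (refill j i)) , (λ j i → proj₂ (proj₂ (refill j i))) , covers′
  where
  refill : ∀ j i → ∃ λ q → restrict (w≤v i) (𝓑 j i) ⊆ q × ∣ q ∣ ≡ k i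
  refill j i = ⊆-extend (restrict (w≤v i) (𝓑 j i))
    (subst (_ ≤_) (isBlock j i) (∣restrict∣≤∣p∣ (w≤v i) (𝓑 j i))) (k≤w i)

  covers′ : ∀ T → Admissible w k t T → ∃ λ j → ContainedIn T (λ i → proj₁ (refill j i))
  covers′ T (∣T∣≤k , ΣT≡t)
    with j , T⊆𝓑 ← covers (λ i → pad (w≤v i) (T i))
           ( (λ i → subst (_≤ k i) (sym (∣pad∣≡∣p∣ (w≤v i) (T i))) (∣T∣≤k i))
           , trans (sumTuple-cong (λ i → ∣pad∣≡∣p∣ (w≤v i) (T i))) ΣT≡t )
    = j , λ i → ⊆-trans (pad⊆⇒⊆restrict (w≤v i) (T⊆𝓑 i)) (proj₁ (proj₂ (refill j i)))

HasGC-growBlocks : ∀ {m} {v k l : Fin m → ℕ} {t n} → (∀ i → t ≤ k i) → k ≤ᵗ l → l ≤ᵗ v →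
  HasGC v k t n → HasGC v l t n
HasGC-growBlocks {v = v} {k} {l} {t} {n} t≤k k≤l l≤v (𝓑 , isBlock , covers) =
  (λ j i → proj₁ (fill j i)) , (λ j i → proj₂ (proj₂ (fill j i))) , covers′
  where
  fill : ∀ j i → ∃ λ q → 𝓑 j i ⊆ q × ∣ q ∣ ≡ l i
  fill j i = ⊆-extend (𝓑 j i) (subst (_≤ l i) (sym (isBlock j i)) (k≤l i)) (l≤v i)

  covers′ : ∀ T → Admissible v l t T → ∃ λ j → ContainedIn T (λ i → proj₁ (fill j i))
  covers′ T (_ , ΣT≡t)
    with j , T⊆𝓑 ← covers T ((λ i → ≤-trans (subst (_ ≤_) ΣT≡t (≤-sumTuple _ i)) (t≤k i)) , ΣT≡t)
    = j , λ i → ⊆-trans (T⊆𝓑 i) (proj₁ (proj₂ (fill j i)))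

coveringNumber-mono : ∀ {m} {v k v′ k′ : Fin m → ℕ} {t t′ c c′} →
  (∃ λ N → HasGC v k t N) → (∀ n → HasGC v k t n → HasGC v′ k′ t′ n) →
  IsCoveringNumber v k t c → IsCoveringNumber v′ k′ t′ c′ → c′ ≤ c
coveringNumber-mono (N , gc) _ (inj₂ (noGC , _)) _ = ⊥-elim (noGC N gc)
coveringNumber-mono _ transfer (inj₁ (gc , _)) (inj₁ (_ , minimal)) = minimal _ (transfer _ gc)
coveringNumber-mono _ _        (inj₁ _)        (inj₂ (_ , refl))     = z≤n

theorem3p17 : (m : ℕ) (v w k l : Fin m → ℕ) →
    (∀ i → 1 ≤ v i) → (∀ i → 1 ≤ w i) → (∀ i → 2 ≤ k i) → (∀ i → 1 ≤ l i) →
    k ≤ᵗ w → w ≤ᵗ v → k ≤ᵗ l → l ≤ᵗ v →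
    (cv cw cl : ℕ) →
    IsCoveringNumber v k 2 cv →
    IsCoveringNumber w k 2 cw →
    IsCoveringNumber v l 2 cl →
    (cw ≤ cv) × (cl ≤ cv)
theorem3p17 m v w k l _ _ 2≤k _ k≤w w≤v k≤l l≤v cv cw cl Cv Cw Cl =
    coveringNumber-mono exists (λ _ → HasGC-shrinkPoints k≤w w≤v) Cv Cw
  , coveringNumber-mono exists (λ _ → HasGC-growBlocks 2≤k k≤l l≤v) Cv Cl
  where
  exists : ∃ λ N → HasGC v k 2 N
  exists = HasGC-exists (λ i → ≤-trans (k≤w i) (w≤v i))
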